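{- Let $G$ be a finite simple graph with no isolated vertices, let $G^-$ be the graph obtained from $G$ by removing all degree-1 vertices, and let $\ell(G)$ be the number of degree-1 vertices of $G^-$. If $\ell(G)>1$, then $h(G)\ge |E(G)|+\lceil \ell(G)/2\rceil$.
   Context: A directed 3-hypergraph $H=(V,F)$ consists of hyperarcs $u,v\to w$ (body $\{u,v\}$ of two distinct vertices, head $w$). The closure $cl_H(S)$ of $S\subseteq V$ is obtained by forward chaining: mark $S$; while some hyperarc $a,b\to c$ has $a,b$ marked and $c$ unmarked, mark $c$. $H$ represents $G=(V,E)$ if for all distinct $u,v$: $(u,v)\in E\Rightarrow cl_H(\{u,v\})=V$ and $(u,v)\notin E\Rightarrow cl_H(\{u,v\})=\{u,v\}$. The hydra number $h(G)$ is the minimum number of hyperarcs of a directed 3-hypergraph on $V$ representing $G$. -}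

module Defs where

open import Data.Nat using (ℕ; _<_; _≤_)
open import Data.Bool using (Bool; true; false; not)
open import Data.Fin using (Fin; toℕ)
open import Data.List using (List; length; filterᵇ; allFin; concatMap; map)
open import Data.List.Membership.Propositional using (_∈_)
open import Data.Product using (_×_; _,_)
open import Data.Sum using (_⊎_)
open import Relation.Binary.PropositionalEquality using (_≡_; _≢_)
open import Relation.Nullary using (¬_)
open import Relation.Nullary.Decidable using (⌊_⌋)
import Data.Nat as N
import Data.Fin as F

record Graph (n : ℕ) : Set where
  field
    adj    : Fin n → Fin n → Bool
    sym    : ∀ i j → adj i j ≡ adj j i
    irrefl : ∀ i → adj i i ≡ false
open Graph public

deg : ∀ {n} → Graph n → Fin n → ℕ
deg G v = length (filterᵇ (adj G v) (allFin _))

numEdges : ∀ {n} → Graph n → ℕ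
numEdges {n} G =
  length (filterᵇ (λ p → ⌊ toℕ (Data.Product.proj₁ p) N.<? toℕ (Data.Product.proj₂ p) ⌋
                          Data.Bool.∧ adj G (Data.Product.proj₁ p) (Data.Product.proj₂ p))
                  (concatMap (λ i → map (λ j → (i , j)) (allFin n)) (allFin n)))

-- vertices of G⁻ : vertices of G whose degree in G is not 1
inMinus : ∀ {n} → Graph n → Fin n → Bool
inMinus G v = not ⌊ deg G v N.≟ 1 ⌋

degMinus : ∀ {n} → Graph n → Fin n → ℕ
degMinus G v = length (filterᵇ (λ w → adj G v w Data.Bool.∧ inMinus G w) (allFin _))

ell : ∀ {n} → Graph n → ℕ
ell G = length (filterᵇ (λ v → inMinus G v Data.Bool.∧ ⌊ degMinus G v N.≟ 1 ⌋) (allFin _))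

-- A hyperarc u,v → w with body {u,v} of two distinct vertices; the body is
-- stored as an ordered pair with toℕ u < toℕ v so each unordered body has a
-- unique representation.
record Hyperarc (n : ℕ) : Set where
  constructor arc
  field
    b₁   : Fin n
    b₂   : Fin n
    b<   : toℕ b₁ < toℕ b₂
    head : Fin n
open Hyperarc public

data Closure {n : ℕ} (F : List (Hyperarc n)) (S : Fin n → Set) : Fin n → Set where
  base : ∀ {x} → S x → Closure F S x
  step : ∀ {e} → e ∈ F → Closure F S (b₁ e) → Closure F S (b₂ e) → Closure F S (head e)

pair : ∀ {n} → Fin n → Fin n → Fin n → Set
pair u v x = x ≡ u ⊎ x ≡ v

Represents : ∀ {n} → List (Hyperarc n) → Graph n → Set
Represents {n} F G = ∀ (u v : Fin n) → u ≢ v →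
  (adj G u v ≡ true → ∀ x → Closure F (pair u v) x) ×
  (adj G u v ≡ false → ∀ x → Closure F (pair u v) x → pair u v x)

-- A hyperarc i,j → h of F is useful if h ∉ {i,j}; only useful arcs can enlarge a closure, their
-- bodies are edges of G, and the numbers K(i,j) of useful arcs with body {i,j} sum to at most |F|.
-- So it suffices to prove 2|E| + ℓ(G) ≤ 2 Σ K(i,j), pair by pair, after distributing the pendant
-- vertices of G⁻ (its degree-1 vertices) over the pairs: a pendant v is paid either by a charge, a
-- useful arc i,j → h into a leaf h of G hanging at v with v ∉ {i,j}, or by a bonus on a pair
-- containing v that carries at least two useful arcs. For an edge ij the closure of {i,j} is all of
-- V, while {i,j} together with charged heads would be closed (a charged head's only neighbour is its
-- pendant, which lies outside); hence some useful head of ij is uncharged, and this leaves room for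
-- the edge itself. That every pendant v is paid is again a closure argument: otherwise the closed
-- neighbourhood of v would be closed under firing although it contains an edge.

module Submission where

open import Defs hiding (sym)
open import Data.Nat using (ℕ; zero; suc; _≤_; _<_; _+_; ⌈_/2⌉; z≤n; s≤s; _≟_; _<?_; _≤?_)
open import Data.Nat.Properties
open import Data.Bool using (Bool; true; false; T; not; _∧_)
open import Data.Bool.Properties using (T-≡; ¬-not)
open import Data.Empty using (⊥; ⊥-elim)
open import Data.Fin using (Fin; zero; suc; toℕ)
import Data.Fin.Properties as Fin
open import Data.List using (List; []; _∷_; _++_; length; filterᵇ; tabulate; allFin; concatMap; map)
open import Data.List.Properties using (filter-++; length-++; map-tabulate)
open import Data.List.Membership.Propositional using (find; lose)
open import Data.List.Relation.Unary.Any using (Any; here; there; any?)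
open import Data.List.Relation.Unary.Unique.Propositional using (Unique)
open import Data.Product using (∃; ∃₂; _×_; _,_; proj₁; proj₂)
open import Data.Sum using (_⊎_; inj₁; inj₂; [_,_]′; swap)
open import Data.Vec.Functional using (updateAt)
open import Data.Vec.Functional.Properties using (updateAt-updates; updateAt-minimal)
open import Function using (_∘_; const; Equivalence)
open import Relation.Nullary using (¬_; Dec; yes; no; does; _because_; _×-dec_; _⊎-dec_; ¬?; contradiction)
open import Relation.Nullary.Decidable using (T?; isYes≗does; decidable-stable)
open import Relation.Unary using (Decidable)
open import Relation.Binary.PropositionalEquality
open import Data.Nat.Tactic.RingSolver using (solve-∀)
open import Algebra.Properties.CommutativeMonoid.Sum +-0-commutativeMonoid
  using (sum; sum-cong-≗; ∑-comm; ∑-distrib-+)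

𝟙 : ∀ {P : Set} → Dec P → ℕ
𝟙 (true  because _) = 1
𝟙 (false because _) = 0

𝟙-T?-does : ∀ {P : Set} (P? : Dec P) → 𝟙 (T? (does P?)) ≡ 𝟙 P?
𝟙-T?-does (yes _) = refl
𝟙-T?-does (no _)  = refl

𝟙-yes : ∀ {P : Set} (P? : Dec P) → P → 𝟙 P? ≡ 1
𝟙-yes (yes _) _ = refl
𝟙-yes (no ¬p) p = contradiction p ¬p

𝟙-no : ∀ {P : Set} (P? : Dec P) → ¬ P → 𝟙 P? ≡ 0
𝟙-no (yes p) ¬p = contradiction p ¬p
𝟙-no (no _)  _  = refl

𝟙≤1 : ∀ {P : Set} (P? : Dec P) → 𝟙 P? ≤ 1
𝟙≤1 (yes _) = ≤-refl
𝟙≤1 (no _)  = z≤n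

𝟙-≤ : ∀ {P : Set} (P? : Dec P) {m} → (P → 1 ≤ m) → 𝟙 P? ≤ m
𝟙-≤ (yes p) 1≤m = 1≤m p
𝟙-≤ (no _)  _   = z≤n

𝟙-mono : ∀ {P Q : Set} (P? : Dec P) (Q? : Dec Q) → (P → Q) → 𝟙 P? ≤ 𝟙 Q?
𝟙-mono (yes p) Q? f = ≤-reflexive (sym (𝟙-yes Q? (f p)))
𝟙-mono (no _)  Q? f = z≤n

𝟙-⊎ : ∀ {P Q R : Set} (P? : Dec P) (Q? : Dec Q) (R? : Dec R) → (P → Q ⊎ R) → 𝟙 P? ≤ 𝟙 Q? + 𝟙 R?
𝟙-⊎ (no _)  Q? R? f = z≤n
𝟙-⊎ (yes p) Q? R? f with f p
... | inj₁ q = ≤-trans (≤-reflexive (sym (𝟙-yes Q? q))) (m≤m+n _ _)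
... | inj₂ r = ≤-trans (≤-reflexive (sym (𝟙-yes R? r))) (m≤n+m _ _)

sum-mono-≤ : ∀ {n} {f g : Fin n → ℕ} → (∀ i → f i ≤ g i) → sum f ≤ sum g
sum-mono-≤ {zero}  f≤g = z≤n
sum-mono-≤ {suc n} f≤g = +-mono-≤ (f≤g zero) (sum-mono-≤ (f≤g ∘ suc))

point≤sum : ∀ {n} (f : Fin n → ℕ) (k : Fin n) → f k ≤ sum f
point≤sum f zero    = m≤m+n _ _
point≤sum f (suc k) = m≤n⇒m≤o+n (f zero) (point≤sum (f ∘ suc) k)

sum-zero : ∀ {n} (f : Fin n → ℕ) → (∀ i → f i ≡ 0) → sum f ≡ 0
sum-zero {zero}  f f≡0 = refl
sum-zero {suc n} f f≡0 = cong₂ _+_ (f≡0 zero) (sum-zero (f ∘ suc) (f≡0 ∘ suc))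

sum-single : ∀ {n} (f : Fin n → ℕ) (k : Fin n) → (∀ i → i ≢ k → f i ≡ 0) → sum f ≡ f k
sum-single f zero    f≡0 = trans (cong (f zero +_) (sum-zero (f ∘ suc) (λ i → f≡0 (suc i) λ ()))) (+-identityʳ _)
sum-single f (suc k) f≡0 = trans (cong (_+ sum (f ∘ suc)) (f≡0 zero λ ()))
                                 (sum-single (f ∘ suc) k (λ i i≢k → f≡0 (suc i) (i≢k ∘ Fin.suc-injective)))

sum-≤-pair : ∀ {n} (f : Fin n → ℕ) (a b : Fin n) → (∀ i → i ≢ a → i ≢ b → f i ≡ 0) → sum f ≤ f a + f b
sum-≤-pair f zero zero f≡0 =
  +-monoʳ-≤ (f zero) (≤-trans (≤-reflexive (sum-zero (f ∘ suc) λ i → f≡0 (suc i) (λ ()) (λ ()))) z≤n)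
sum-≤-pair f zero (suc b) f≡0 =
  +-monoʳ-≤ (f zero) (≤-reflexive (sum-single (f ∘ suc) b λ i i≢b → f≡0 (suc i) (λ ()) (i≢b ∘ Fin.suc-injective)))
sum-≤-pair f (suc a) zero f≡0 =
  subst (sum f ≤_) (+-comm (f zero) (f (suc a))) (sum-≤-pair f zero (suc a) λ i i≢0 i≢a → f≡0 i i≢a i≢0)
sum-≤-pair f (suc a) (suc b) f≡0 = subst (λ x → x + sum (f ∘ suc) ≤ f (suc a) + f (suc b)) (sym (f≡0 zero (λ ()) (λ ())))
  (sum-≤-pair (f ∘ suc) a b λ i i≢a i≢b → f≡0 (suc i) (i≢a ∘ Fin.suc-injective) (i≢b ∘ Fin.suc-injective))

sum-<-at : ∀ {n} {f g : Fin n → ℕ} (k : Fin n) → (∀ i → f i ≤ g i) → f k < g k → sum f < sum g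
sum-<-at zero    f≤g fk<gk = +-mono-<-≤ fk<gk (sum-mono-≤ (f≤g ∘ suc))
sum-<-at (suc k) f≤g fk<gk = +-mono-≤-< (f≤g zero) (sum-<-at k (f≤g ∘ suc) fk<gk)

sum-<-at₂ : ∀ {n} {f g : Fin n → ℕ} (a b : Fin n) → a ≢ b → (∀ i → f i ≤ g i) →
            f a < g a → f b < g b → 2 + sum f ≤ sum g
sum-<-at₂ {n} {f} {g} a b a≢b f≤g fa<ga fb<gb =
  ≤-trans (s≤s (sum-<-at a f≤h (subst (f a <_) (sym h-at-a) fa<ga)))
          (sum-<-at b h≤g (subst (_< g b) (sym h-at-b) fb<gb))
  where
  h : Fin n → ℕ
  h = updateAt f a (const (g a))
  h-at-a : h a ≡ g a
  h-at-a = updateAt-updates a f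
  h-off-a : ∀ i → i ≢ a → h i ≡ f i
  h-off-a i i≢a = updateAt-minimal i a f i≢a
  h-at-b : h b ≡ f b
  h-at-b = h-off-a b (a≢b ∘ sym)
  f≤h : ∀ i → f i ≤ h i
  f≤h i with i Fin.≟ a
  ... | yes refl = ≤-trans (f≤g i) (≤-reflexive (sym h-at-a))
  ... | no i≢a   = ≤-reflexive (sym (h-off-a i i≢a))
  h≤g : ∀ i → h i ≤ g i
  h≤g i with i Fin.≟ a
  ... | yes refl = ≤-reflexive h-at-a
  ... | no i≢a   = ≤-trans (≤-reflexive (h-off-a i i≢a)) (f≤g i)

∑² : ∀ {n} → (Fin n → Fin n → ℕ) → ℕ
∑² f = sum λ i → sum λ j → f i j

∑²-distrib-+ : ∀ {n} (f g : Fin n → Fin n → ℕ) → ∑² (λ i j → f i j + g i j) ≡ ∑² f + ∑² g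
∑²-distrib-+ f g = trans (sum-cong-≗ λ i → ∑-distrib-+ (f i) (g i)) (∑-distrib-+ (λ i → sum (f i)) (λ i → sum (g i)))

point≤∑² : ∀ {n} (f : Fin n → Fin n → ℕ) i j → f i j ≤ ∑² f
point≤∑² f i j = ≤-trans (point≤sum (f i) j) (point≤sum (λ i → sum (f i)) i)

∑-∑²-comm : ∀ {m n} (f : Fin m → Fin n → Fin n → ℕ) → sum (λ v → ∑² (f v)) ≡ ∑² (λ i j → sum (λ v → f v i j))
∑-∑²-comm f = trans (∑-comm (λ v i → sum (f v i))) (sum-cong-≗ λ i → ∑-comm (λ v j → f v i j))

∑²-mono-≤ : ∀ {n} {f g : Fin n → Fin n → ℕ} → (∀ i j → f i j ≤ g i j) → ∑² f ≤ ∑² g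
∑²-mono-≤ f≤g = sum-mono-≤ λ i → sum-mono-≤ (f≤g i)

count : ∀ {n} {P : Fin n → Set} → Decidable P → ℕ
count P? = sum (λ i → 𝟙 (P? i))

module _ {n} {P : Fin n → Set} (P? : Decidable P) where

  count≥1 : ∀ {k} → P k → 1 ≤ count P?
  count≥1 {k} p = ≤-trans (≤-reflexive (sym (𝟙-yes (P? k) p))) (point≤sum _ k)

  count-none : (∀ i → ¬ P i) → count P? ≡ 0
  count-none ¬P = sum-zero _ (λ i → 𝟙-no (P? i) (¬P i))

  count-witness : 1 ≤ count P? → ∃ P
  count-witness c with Fin.any? P?
  ... | yes w = w
  ... | no ¬w = contradiction (≤-trans c (≤-reflexive (count-none (λ i p → ¬w (i , p))))) λ ()

  count-unique : count P? ≤ 1 → ∀ {a b} → P a → P b → a ≡ b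
  count-unique c {a} {b} pa pb with a Fin.≟ b
  ... | yes a≡b = a≡b
  ... | no a≢b = contradiction (≤-trans two≤count c) λ { (s≤s ()) }
    where
    two≤count : 2 ≤ count P?
    two≤count = subst (λ s → 2 + s ≤ count P?) (sum-zero {n} (const 0) (λ _ → refl))
      (sum-<-at₂ {f = const 0} a b a≢b (λ _ → z≤n)
        (≤-reflexive (sym (𝟙-yes (P? a) pa))) (≤-reflexive (sym (𝟙-yes (P? b) pb))))

  count≤1 : (∀ {a b} → P a → P b → a ≡ b) → count P? ≤ 1
  count≤1 unique with Fin.any? P?
  ... | no ¬w = ≤-trans (≤-reflexive (count-none (λ i p → ¬w (i , p)))) z≤n
  ... | yes (k , pk) = ≤-trans (≤-reflexive (sum-single _ k off-k)) (𝟙≤1 (P? k))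
    where
    off-k : ∀ i → i ≢ k → 𝟙 (P? i) ≡ 0
    off-k i i≢k = 𝟙-no (P? i) (λ pi → i≢k (unique pi pk))

count-mono : ∀ {n} {P Q : Fin n → Set} (P? : Decidable P) (Q? : Decidable Q) →
             (∀ {i} → P i → Q i) → count P? ≤ count Q?
count-mono P? Q? P⇒Q = sum-mono-≤ (λ i → 𝟙-mono (P? i) (Q? i) P⇒Q)

count-×-≤ : ∀ {n} {P : Set} {Q : Fin n → Set} (P? : Dec P) (Q? : Decidable Q) →
            (∀ {a b} → Q a → Q b → a ≡ b) → count (λ i → P? ×-dec Q? i) ≤ 𝟙 P?
count-×-≤ (yes p) Q? unique = count≤1 (λ i → yes p ×-dec Q? i) (λ qa qb → unique (proj₂ qa) (proj₂ qb))
count-×-≤ (no ¬p) Q? unique = ≤-reflexive (count-none (λ i → no ¬p ×-dec Q? i) (λ _ → ¬p ∘ proj₁))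

length-filterᵇ-tabulate : ∀ {A : Set} {n} (p : A → Bool) (f : Fin n → A) →
                          length (filterᵇ p (tabulate f)) ≡ sum (λ i → 𝟙 (T? (p (f i))))
length-filterᵇ-tabulate {n = zero}  p f = refl
length-filterᵇ-tabulate {n = suc n} p f with p (f zero)
... | true  = cong suc (length-filterᵇ-tabulate p (f ∘ suc))
... | false = length-filterᵇ-tabulate p (f ∘ suc)

length-filterᵇ-concatMap : ∀ {A B : Set} {n} (p : B → Bool) (g : A → List B) (f : Fin n → A) →
  length (filterᵇ p (concatMap g (tabulate f))) ≡ sum (λ i → length (filterᵇ p (g (f i))))
length-filterᵇ-concatMap {n = zero}  p g f = refl
length-filterᵇ-concatMap {n = suc n} p g f = begin
  length (filterᵇ p (g (f zero) ++ concatMap g (tabulate (f ∘ suc))))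
    ≡⟨ cong length (filter-++ (T? ∘ p) (g (f zero)) _) ⟩
  length (filterᵇ p (g (f zero)) ++ filterᵇ p (concatMap g (tabulate (f ∘ suc))))
    ≡⟨ length-++ (filterᵇ p (g (f zero))) ⟩
  length (filterᵇ p (g (f zero))) + length (filterᵇ p (concatMap g (tabulate (f ∘ suc))))
    ≡⟨ cong (length (filterᵇ p (g (f zero))) +_) (length-filterᵇ-concatMap p g (f ∘ suc)) ⟩
  sum (λ i → length (filterᵇ p (g (f i))))
    ∎
  where open ≡-Reasoning

count-T? : ∀ {n} (p : Fin n → Bool) {Q : Fin n → Set} (Q? : Decidable Q) →
  (∀ i → p i ≡ does (Q? i)) → sum (λ i → 𝟙 (T? (p i))) ≡ count Q?
count-T? p Q? p≡Q? = sum-cong-≗ λ i → trans (cong (𝟙 ∘ T?) (p≡Q? i)) (𝟙-T?-does (Q? i))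

length-filterᵇ-allFin : ∀ {n} (p : Fin n → Bool) {Q : Fin n → Set} (Q? : Decidable Q) →
  (∀ i → p i ≡ does (Q? i)) → length (filterᵇ p (allFin n)) ≡ count Q?
length-filterᵇ-allFin p Q? p≡Q? = trans (length-filterᵇ-tabulate p (λ i → i)) (count-T? p Q? p≡Q?)

length-filterᵇ-pairs : ∀ {n} (p : Fin n × Fin n → Bool) {Q : Fin n → Fin n → Set} (Q? : ∀ i → Decidable (Q i)) →
  (∀ i j → p (i , j) ≡ does (Q? i j)) →
  length (filterᵇ p (concatMap (λ i → map (i ,_) (allFin n)) (allFin n))) ≡ sum (λ i → count (Q? i))
length-filterᵇ-pairs {n} p Q? p≡Q? =
  trans (length-filterᵇ-concatMap {n = n} p (λ i → map (i ,_) (allFin n)) (λ i → i)) (sum-cong-≗ λ i →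
    trans (cong (length ∘ filterᵇ p) (map-tabulate (λ j → j) (i ,_)))
          (trans (length-filterᵇ-tabulate p (i ,_)) (count-T? (λ j → p (i , j)) (Q? i) (p≡Q? i))))

budget-single : ∀ {e s b k} → e ≤ 1 → s + e ≤ k → b ≤ 1 → (1 ≤ b → 2 ≤ k) → e + e + (s + b) ≤ k + k
budget-single {e} {s} {b} {k} e≤1 s+e≤k b≤1 b⇒2≤k =
  ≤-trans (≤-reflexive (rearrange e s b)) (+-mono-≤ s+e≤k (e+b≤k b≤1 b⇒2≤k))
  where
  rearrange : ∀ e s b → e + e + (s + b) ≡ s + e + (e + b)
  rearrange = solve-∀
  e+b≤k : ∀ {b} → b ≤ 1 → (1 ≤ b → 2 ≤ k) → e + b ≤ k
  e+b≤k z≤n       _     = subst (_≤ k) (sym (+-identityʳ e)) (m+n≤o⇒n≤o s s+e≤k)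
  e+b≤k (s≤s z≤n) 1⇒2≤k = ≤-trans (+-monoˡ-≤ 1 e≤1) (1⇒2≤k ≤-refl)

budget-double : ∀ {e s b k} → e ≤ 1 → 2 + s ≤ k → b ≤ 2 → e + e + (s + b) ≤ k + k
budget-double {e} {s} {b} {k} e≤1 2+s≤k b≤2 = begin
  e + e + (s + b) ≤⟨ +-monoʳ-≤ (e + e) (+-monoʳ-≤ s b≤2) ⟩
  e + e + (s + 2) ≡⟨ +-comm (e + e) (s + 2) ⟩
  s + 2 + (e + e) ≤⟨ +-mono-≤ (subst (_≤ k) (+-comm 2 s) 2+s≤k) (≤-trans (+-mono-≤ e≤1 e≤1) (m+n≤o⇒m≤o 2 2+s≤k)) ⟩
  k + k           ∎
  where open ≤-Reasoning

⌈m+m+n/2⌉≡m+⌈n/2⌉ : ∀ m n → ⌈ m + m + n /2⌉ ≡ m + ⌈ n /2⌉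
⌈m+m+n/2⌉≡m+⌈n/2⌉ zero    n = refl
⌈m+m+n/2⌉≡m+⌈n/2⌉ (suc m) n = trans (cong (λ x → ⌈ suc x + n /2⌉) (+-suc m m)) (cong suc (⌈m+m+n/2⌉≡m+⌈n/2⌉ m n))

2≰⇒≤1 : ∀ {k} → ¬ 2 ≤ k → k ≤ 1
2≰⇒≤1 = ≤-pred ∘ ≰⇒>

half-bound : ∀ {m n k} → m + m + n ≤ k + k → m + ⌈ n /2⌉ ≤ k
half-bound {m} {n} {k} le = begin
  m + ⌈ n /2⌉         ≡⟨ sym (⌈m+m+n/2⌉≡m+⌈n/2⌉ m n) ⟩
  ⌈ m + m + n /2⌉     ≤⟨ ⌈n/2⌉-mono le ⟩
  ⌈ k + k /2⌉         ≡⟨ sym (n≡⌈n+n/2⌉ k) ⟩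
  k                   ∎
  where open ≤-Reasoning

in-pair-distinct : ∀ {A : Set} {x y a b : A} → a ≢ b → a ≡ x ⊎ a ≡ y → b ≡ x ⊎ b ≡ y →
                   (a ≡ x × b ≡ y) ⊎ (a ≡ y × b ≡ x)
in-pair-distinct a≢b (inj₁ refl) (inj₁ refl) = contradiction refl a≢b
in-pair-distinct a≢b (inj₁ a≡x)  (inj₂ b≡y)  = inj₁ (a≡x , b≡y)
in-pair-distinct a≢b (inj₂ a≡y)  (inj₁ b≡x)  = inj₂ (a≡y , b≡x)
in-pair-distinct a≢b (inj₂ refl) (inj₂ refl) = contradiction refl a≢b

module GraphFacts {n : ℕ} (G : Graph n) where

  Adj : Fin n → Fin n → Set
  Adj i j = T (adj G i j)

  Adj? : ∀ i j → Dec (Adj i j)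
  Adj? i j = T? (adj G i j)

  adj-sym : ∀ {i j} → Adj i j → Adj j i
  adj-sym {i} {j} = subst T (Graph.sym G i j)

  adj-irrefl : ∀ {i j} → Adj i j → i ≢ j
  adj-irrefl {i} a refl = subst T (irrefl G i) a

  Leaf : Fin n → Set
  Leaf v = deg G v ≡ 1

  Leaf? : ∀ v → Dec (Leaf v)
  Leaf? v = deg G v ≟ 1

  LeafNbr : Fin n → Fin n → Set
  LeafNbr v h = Adj v h × Leaf h

  Pendant : Fin n → Set
  Pendant v = ¬ Leaf v × degMinus G v ≡ 1

  Pendant? : ∀ v → Dec (Pendant v)
  Pendant? v = ¬? (Leaf? v) ×-dec (degMinus G v ≟ 1)

  Edge : Fin n → Fin n → Set
  Edge i j = toℕ i < toℕ j × Adj i j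

  Edge? : ∀ i j → Dec (Edge i j)
  Edge? i j = (toℕ i <? toℕ j) ×-dec Adj? i j

  deg≡count : ∀ v → deg G v ≡ count (Adj? v)
  deg≡count v = length-filterᵇ-allFin (adj G v) (Adj? v) (λ _ → refl)

  degMinus≡count : ∀ v → degMinus G v ≡ count (λ w → Adj? v w ×-dec ¬? (Leaf? w))
  degMinus≡count v = length-filterᵇ-allFin _ _ (λ w → cong (λ b → adj G v w ∧ not b) (isYes≗does (Leaf? w)))

  ell≡count : ell G ≡ count Pendant?
  ell≡count = length-filterᵇ-allFin _ Pendant? (λ v →
    cong₂ (λ b c → not b ∧ c) (isYes≗does (Leaf? v)) (isYes≗does (degMinus G v ≟ 1)))

  numEdges≡sum : numEdges G ≡ sum (λ i → count (Edge? i))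
  numEdges≡sum = length-filterᵇ-pairs _ Edge? (λ i j → cong (_∧ adj G i j) (isYes≗does (toℕ i <? toℕ j)))

  leaf-nbr-unique : ∀ {h a b} → Leaf h → Adj h a → Adj h b → a ≡ b
  leaf-nbr-unique {h} leaf = count-unique (Adj? h) (≤-reflexive (trans (sym (deg≡count h)) leaf))

  module _ (no-isolated : ∀ v → 1 ≤ deg G v) where

    nonleaf-other-nbr : ∀ {z} → ¬ Leaf z → ∀ a → ∃ λ y → Adj z y × y ≢ a
    nonleaf-other-nbr {z} ¬leaf a with Fin.any? (λ y → Adj? z y ×-dec ¬? (y Fin.≟ a))
    ... | yes found = found
    ... | no ¬found = contradiction (≤-antisym deg≤1 (no-isolated z)) ¬leaf
      where
      nbr≡a : ∀ {y} → Adj z y → y ≡ a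
      nbr≡a {y} zy = decidable-stable (y Fin.≟ a) (λ y≢a → ¬found (y , zy , y≢a))
      deg≤1 : deg G z ≤ 1
      deg≤1 = subst (_≤ 1) (sym (deg≡count z)) (count≤1 (Adj? z) (λ zb zc → trans (nbr≡a zb) (sym (nbr≡a zc))))

    module PendantStructure {v} (pendant : Pendant v) where

      private
        nonleaf-nbr-count : count (λ w → Adj? v w ×-dec ¬? (Leaf? w)) ≡ 1
        nonleaf-nbr-count = trans (sym (degMinus≡count v)) (proj₂ pendant)

        -- Opaque: unfolding this witness inside later types makes type checking very slow.
        opaque
          core-exists : ∃ λ w → Adj v w × ¬ Leaf w
          core-exists = count-witness _ (≤-reflexive (sym nonleaf-nbr-count))

      core : Fin n
      core = proj₁ core-exists

      adj-core : Adj v core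
      adj-core = proj₁ (proj₂ core-exists)

      core-nonleaf : ¬ Leaf core
      core-nonleaf = proj₂ (proj₂ core-exists)

      core-unique : ∀ {z} → Adj v z → ¬ Leaf z → z ≡ core
      core-unique vz ¬leaf = count-unique _ (≤-reflexive nonleaf-nbr-count) (vz , ¬leaf) (adj-core , core-nonleaf)

      nbr-core-or-leaf : ∀ {z} → Adj v z → z ≡ core ⊎ Leaf z
      nbr-core-or-leaf {z} vz with Leaf? z
      ... | yes leaf = inj₂ leaf
      ... | no ¬leaf = inj₁ (core-unique vz ¬leaf)

      leaf-nbr : ∃ (LeafNbr v)
      leaf-nbr with nonleaf-other-nbr (proj₁ pendant) core
      ... | x , vx , x≢core with nbr-core-or-leaf vx
      ...   | inj₁ x≡core = contradiction x≡core x≢core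
      ...   | inj₂ leaf = x , vx , leaf

      beyond-core : ∃ λ y → Adj core y × y ≢ v
      beyond-core = nonleaf-other-nbr core-nonleaf v

module Arcs {n : ℕ} where

  Match : Hyperarc n → Fin n → Fin n → Fin n → Set
  Match e i j h = (b₁ e ≡ i × b₂ e ≡ j) × head e ≡ h

  Match? : ∀ e i j h → Dec (Match e i j h)
  Match? e i j h = ((b₁ e Fin.≟ i) ×-dec (b₂ e Fin.≟ j)) ×-dec (head e Fin.≟ h)

  Arc : List (Hyperarc n) → Fin n → Fin n → Fin n → Set
  Arc L i j h = Any (λ e → Match e i j h) L

  Arc? : ∀ L i j h → Dec (Arc L i j h)
  Arc? L i j h = any? (λ e → Match? e i j h) L

  arc-ordered : ∀ {L i j h} → Arc L i j h → toℕ i < toℕ j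
  arc-ordered a with find a
  ... | e , _ , (refl , refl) , _ = b< e

  match-count≤1 : ∀ e → ∑² (λ i j → count (Match? e i j)) ≤ 1
  match-count≤1 e = begin
    ∑² (λ i j → count (Match? e i j))
      ≤⟨ ∑²-mono-≤ (λ i j → count-×-≤ (body? i j) (head e Fin.≟_) same) ⟩
    sum (λ i → count (body? i))
      ≤⟨ sum-mono-≤ (λ i → count-×-≤ (b₁ e Fin.≟ i) (b₂ e Fin.≟_) same) ⟩
    count (b₁ e Fin.≟_)
      ≤⟨ count≤1 (b₁ e Fin.≟_) same ⟩
    1
      ∎
    where
    open ≤-Reasoning
    body? : ∀ i j → Dec (b₁ e ≡ i × b₂ e ≡ j)
    body? i j = (b₁ e Fin.≟ i) ×-dec (b₂ e Fin.≟ j)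
    same : ∀ {x y z : Fin n} → x ≡ y → x ≡ z → y ≡ z
    same p q = trans (sym p) q

  arc-count≤length : ∀ L → ∑² (λ i j → count (Arc? L i j)) ≤ length L
  arc-count≤length [] = ≤-reflexive (sum-zero _ λ i → sum-zero _ λ j → count-none (Arc? [] i j) (λ _ ()))
  arc-count≤length (e ∷ L) = begin
    ∑² (λ i j → count (Arc? (e ∷ L) i j))
      ≤⟨ ∑²-mono-≤ (λ i j → sum-mono-≤ λ h → 𝟙-⊎ (Arc? (e ∷ L) i j h) (Match? e i j h) (Arc? L i j h) here-or-there) ⟩
    ∑² (λ i j → sum (λ h → 𝟙 (Match? e i j h) + 𝟙 (Arc? L i j h)))
      ≡⟨ trans (sum-cong-≗ λ i → sum-cong-≗ λ j → ∑-distrib-+ (λ h → 𝟙 (Match? e i j h)) (λ h → 𝟙 (Arc? L i j h)))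
               (∑²-distrib-+ (λ i j → count (Match? e i j)) (λ i j → count (Arc? L i j))) ⟩
    ∑² (λ i j → count (Match? e i j)) + ∑² (λ i j → count (Arc? L i j))
      ≤⟨ +-mono-≤ (match-count≤1 e) (arc-count≤length L) ⟩
    suc (length L)
      ∎
    where
    open ≤-Reasoning
    here-or-there : ∀ {P : Hyperarc n → Set} → Any P (e ∷ L) → P e ⊎ Any P L
    here-or-there (here p)  = inj₁ p
    here-or-there (there p) = inj₂ p

module Representation {n : ℕ} (G : Graph n) (F : List (Hyperarc n)) (represents : Represents F G)
                      (no-isolated : ∀ v → 1 ≤ deg G v) where

  open GraphFacts G
  open Arcs

  Useful : Fin n → Fin n → Fin n → Set
  Useful i j h = Arc F i j h × h ≢ i × h ≢ j

  Useful? : ∀ i j h → Dec (Useful i j h)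
  Useful? i j h = Arc? F i j h ×-dec ¬? (h Fin.≟ i) ×-dec ¬? (h Fin.≟ j)

  useful-ordered : ∀ {i j h} → Useful i j h → toℕ i < toℕ j
  useful-ordered = arc-ordered ∘ proj₁

  non-edge-closure-trivial : ∀ {a b} → a ≢ b → ¬ Adj a b → ∀ {x} → Closure F (pair a b) x → pair a b x
  non-edge-closure-trivial a≢b ¬ab = proj₂ (represents _ _ a≢b) (¬-not (¬ab ∘ Equivalence.from T-≡)) _

  edge-closure-total : ∀ {a b} → Adj a b → ∀ x → Closure F (pair a b) x
  edge-closure-total ab = proj₁ (represents _ _ (adj-irrefl ab)) (Equivalence.to T-≡ ab)

  useful-adjacent : ∀ {i j h} → Useful i j h → Adj i j
  useful-adjacent (a , h≢i , h≢j) with find a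
  ... | e , e∈F , (refl , refl) , refl with Adj? (b₁ e) (b₂ e)
  ...   | yes adjacent = adjacent
  ...   | no ¬adjacent = ⊥-elim ([ h≢i , h≢j ]′ (non-edge-closure-trivial (<⇒≢ (b< e) ∘ cong toℕ) ¬adjacent
                                                   (step e∈F (base (inj₁ refl)) (base (inj₂ refl)))))

  Fires : Fin n → Fin n → Fin n → Set
  Fires a b h = Useful a b h ⊎ Useful b a h

  Fires? : ∀ a b h → Dec (Fires a b h)
  Fires? a b h = Useful? a b h ⊎-dec Useful? b a h

  fires-sym : ∀ {a b h} → Fires a b h → Fires b a h
  fires-sym = swap

  FiresClosed : (Fin n → Set) → Set
  FiresClosed M = ∀ {a b h} → Adj a b → Fires a b h → M a → M b → M h

  closure-least : ∀ {S M : Fin n → Set} → FiresClosed M → (∀ {x} → S x → M x) → ∀ {x} → Closure F S x → M x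
  closure-least closed S⊆M (base s) = S⊆M s
  closure-least {M = M} closed S⊆M (step {e} e∈F c₁ c₂)
    with head e Fin.≟ b₁ e | head e Fin.≟ b₂ e | closure-least closed S⊆M c₁ | closure-least closed S⊆M c₂
  ... | yes h≡b₁ | _        | m₁ | m₂ = subst M (sym h≡b₁) m₁
  ... | no _     | yes h≡b₂ | m₁ | m₂ = subst M (sym h≡b₂) m₂
  ... | no h≢b₁  | no h≢b₂  | m₁ | m₂ = closed (useful-adjacent useful) (inj₁ useful) m₁ m₂
    where
    useful : Useful (b₁ e) (b₂ e) (head e)
    useful = lose e∈F ((refl , refl) , refl) , h≢b₁ , h≢b₂

  fires-closed-total : ∀ {M a b} → Adj a b → FiresClosed M → M a → M b → ∀ z → M z
  fires-closed-total {M} {a} {b} ab closed ma mb z =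
    closure-least closed pair⊆M (edge-closure-total ab z)
    where
    pair⊆M : ∀ {x} → pair a b x → M x
    pair⊆M (inj₁ refl) = ma
    pair⊆M (inj₂ refl) = mb

  usefulCount : Fin n → Fin n → ℕ
  usefulCount i j = count (Useful? i j)

  usefulCount≤length : ∑² usefulCount ≤ length F
  usefulCount≤length = ≤-trans (∑²-mono-≤ λ i j → count-mono (Useful? i j) (Arc? F i j) proj₁) (arc-count≤length F)

  fires-unique : ∀ {i j h₀ h} → usefulCount i j ≤ 1 → Useful i j h₀ → Fires i j h → h ≡ h₀
  fires-unique {i} {j} K≤1 u₀ (inj₁ u) = count-unique (Useful? i j) K≤1 u u₀
  fires-unique         K≤1 u₀ (inj₂ u) = contradiction (useful-ordered u₀) (<-asym (useful-ordered u))

  fires-unique₂ : ∀ {a b h h′} → usefulCount a b ≤ 1 → usefulCount b a ≤ 1 → Fires a b h → Fires a b h′ → h ≡ h′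
  fires-unique₂ Kab≤1 Kba≤1 (inj₁ u) f′ = sym (fires-unique Kab≤1 u f′)
  fires-unique₂ Kab≤1 Kba≤1 (inj₂ u) f′ = sym (fires-unique Kba≤1 u (fires-sym f′))

  LeafNbr? : ∀ v h → Dec (LeafNbr v h)
  LeafNbr? v h = Adj? v h ×-dec Leaf? h

  Charges : Fin n → Fin n → Fin n → Fin n → Set
  Charges v i j h = Pendant v × LeafNbr v h × v ≢ i × v ≢ j

  Charges? : ∀ v i j h → Dec (Charges v i j h)
  Charges? v i j h = Pendant? v ×-dec LeafNbr? v h ×-dec ¬? (v Fin.≟ i) ×-dec ¬? (v Fin.≟ j)

  charger-unique : ∀ {i j h v v′} → Charges v i j h → Charges v′ i j h → v ≡ v′
  charger-unique (_ , (vh , leaf) , _) (_ , (v′h , _) , _) = leaf-nbr-unique leaf (adj-sym vh) (adj-sym v′h)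

  Owns : Fin n → Fin n → Fin n → Set
  Owns v i j = ∃ λ h → Useful i j h × LeafNbr v h

  -- The Owns alternative makes two bonuses on one pair affordable (both-bonus).
  Bonus : Fin n → Fin n → Fin n → Set
  Bonus v i j = Pendant v × (v ≡ i ⊎ v ≡ j) × 2 ≤ usefulCount i j × (Leaf i ⊎ Leaf j ⊎ Owns v i j)

  Bonus? : ∀ v i j → Dec (Bonus v i j)
  Bonus? v i j = Pendant? v ×-dec ((v Fin.≟ i) ⊎-dec (v Fin.≟ j)) ×-dec (2 ≤? usefulCount i j)
    ×-dec (Leaf? i ⊎-dec Leaf? j ⊎-dec Fin.any? (λ h → Useful? i j h ×-dec LeafNbr? v h))

  chargedBy : Fin n → Fin n → Fin n → ℕ
  chargedBy v i j = count (λ h → Useful? i j h ×-dec Charges? v i j h)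

  charged : Fin n → Fin n → ℕ
  charged i j = sum (λ v → chargedBy v i j)

  bonus : Fin n → Fin n → ℕ
  bonus i j = count (λ v → Bonus? v i j)

  chargedAt : Fin n → Fin n → Fin n → ℕ
  chargedAt i j h = count (λ v → Useful? i j h ×-dec Charges? v i j h)

  charged≡sum-chargedAt : ∀ i j → charged i j ≡ sum (chargedAt i j)
  charged≡sum-chargedAt i j = ∑-comm (λ v h → 𝟙 (Useful? i j h ×-dec Charges? v i j h))

  chargedAt≤useful : ∀ i j h → chargedAt i j h ≤ 𝟙 (Useful? i j h)
  chargedAt≤useful i j h = count-×-≤ (Useful? i j h) (λ v → Charges? v i j h) charger-unique

  charged≤usefulCount : ∀ i j → charged i j ≤ usefulCount i j
  charged≤usefulCount i j = ≤-trans (≤-reflexive (charged≡sum-chargedAt i j)) (sum-mono-≤ (chargedAt≤useful i j))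

  chargedAt<useful : ∀ {i j h} → Useful i j h → ¬ ∃ (λ v → Charges v i j h) → chargedAt i j h < 𝟙 (Useful? i j h)
  chargedAt<useful {i} {j} {h} u ¬charged = subst₂ _<_
    (sym (count-none (λ v → Useful? i j h ×-dec Charges? v i j h) (λ v uc → ¬charged (v , proj₂ uc))))
    (sym (𝟙-yes (Useful? i j h) u)) ≤-refl

  module PendantOf {v} (pendant : Pendant v) = PendantStructure no-isolated pendant

  module EdgeSpan {i j} (edge : Edge i j) (all-charged : ∀ {h} → Useful i j h → ∃ λ v → Charges v i j h) where

    OnEdge : Fin n → Set
    OnEdge x = x ≡ i ⊎ x ≡ j

    Span : Fin n → Set
    Span x = OnEdge x ⊎ Useful i j x

    useful-leaf : ∀ {z} → Useful i j z → Leaf z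
    useful-leaf u with all-charged u
    ... | _ , _ , (_ , leaf) , _ = leaf

    charger-off-edge : ∀ {z v} → Charges v i j z → ¬ OnEdge v
    charger-off-edge (_ , _ , v≢i , v≢j) = [ v≢i , v≢j ]′

    nonleaf-outside : ∀ {z} → ¬ Leaf z → ¬ OnEdge z → ¬ Span z
    nonleaf-outside ¬leaf ¬on (inj₁ on) = ¬on on
    nonleaf-outside ¬leaf ¬on (inj₂ u)  = ¬leaf (useful-leaf u)

    useful-isolated : ∀ {z y} → Useful i j z → Adj z y → ¬ Span y
    useful-isolated {z} {y} u zy with all-charged u
    ... | v , charges@(pendant , (vz , leaf) , _) with leaf-nbr-unique leaf zy (adj-sym vz)
    ...   | refl = nonleaf-outside (proj₁ pendant) (charger-off-edge charges)

    from-ends : ∀ {a b h} → Adj a b → Fires a b h → OnEdge a → OnEdge b → Useful i j h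
    from-ends ab fires ea eb with in-pair-distinct (adj-irrefl ab) ea eb | fires
    ... | inj₁ (refl , refl) | inj₁ u = u
    ... | inj₁ (refl , refl) | inj₂ u = contradiction (proj₁ edge) (<-asym (useful-ordered u))
    ... | inj₂ (refl , refl) | inj₁ u = contradiction (proj₁ edge) (<-asym (useful-ordered u))
    ... | inj₂ (refl , refl) | inj₂ u = u

    span-closed : FiresClosed Span
    span-closed ab fires (inj₂ ua)  mb         = ⊥-elim (useful-isolated ua ab mb)
    span-closed ab fires ma         (inj₂ ub)  = ⊥-elim (useful-isolated ub (adj-sym ab) ma)
    span-closed ab fires (inj₁ ea) (inj₁ eb)   = inj₂ (from-ends ab fires ea eb)

    vertex-outside : ∀ {v₀} → Pendant v₀ → ∃ λ z → ¬ Span z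
    vertex-outside {v₀} p₀ with (v₀ Fin.≟ i) ⊎-dec (v₀ Fin.≟ j)
    ... | no v₀-off = v₀ , nonleaf-outside (proj₁ p₀) v₀-off
    ... | yes v₀-on with PendantOf.leaf-nbr p₀
    ...   | x , v₀x , x-leaf with (x Fin.≟ i) ⊎-dec (x Fin.≟ j)
    ...     | no x-off = x , λ
                { (inj₁ x-on) → x-off x-on
                ; (inj₂ u) → let (v , charges@(_ , (vx , _) , _)) = all-charged u in
                    charger-off-edge charges (subst OnEdge (leaf-nbr-unique x-leaf (adj-sym v₀x) (adj-sym vx)) v₀-on) }
    ...     | yes x-on = core , nonleaf-outside core-nonleaf core-off
      where
      open PendantOf p₀
      core≢v₀ : core ≢ v₀
      core≢v₀ = adj-irrefl adj-core ∘ sym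
      core≢x : core ≢ x
      core≢x core≡x = core-nonleaf (subst Leaf (sym core≡x) x-leaf)
      core-off : ¬ OnEdge core
      core-off on with in-pair-distinct (adj-irrefl v₀x) v₀-on x-on | on
      ... | inj₁ (v₀≡i , x≡j) | inj₁ core≡i = core≢v₀ (trans core≡i (sym v₀≡i))
      ... | inj₁ (v₀≡i , x≡j) | inj₂ core≡j = core≢x  (trans core≡j (sym x≡j))
      ... | inj₂ (v₀≡j , x≡i) | inj₁ core≡i = core≢x  (trans core≡i (sym x≡i))
      ... | inj₂ (v₀≡j , x≡i) | inj₂ core≡j = core≢v₀ (trans core≡j (sym v₀≡j))

    impossible : ∀ {v₀} → Pendant v₀ → ⊥
    impossible p₀ with vertex-outside p₀
    ... | z , z-off = z-off (fires-closed-total (proj₂ edge) span-closed (inj₁ (inj₁ refl)) (inj₁ (inj₂ refl)) z)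

  edge-has-uncharged-head : ∀ {v₀ i j} → Pendant v₀ → Edge i j → ∃ λ h → Useful i j h × ¬ ∃ (λ v → Charges v i j h)
  edge-has-uncharged-head {v₀} {i} {j} p₀ edge
    with Fin.any? (λ h → Useful? i j h ×-dec ¬? (Fin.any? λ v → Charges? v i j h))
  ... | yes found = found
  ... | no ¬found = ⊥-elim (EdgeSpan.impossible edge all-charged p₀)
    where
    all-charged : ∀ {h} → Useful i j h → ∃ λ v → Charges v i j h
    all-charged {h} u = decidable-stable (Fin.any? λ v → Charges? v i j h) (λ ¬charged → ¬found (h , u , ¬charged))

  charged<usefulCount : ∀ {i j h} → Useful i j h → ¬ ∃ (λ v → Charges v i j h) → charged i j < usefulCount i j
  charged<usefulCount {i} {j} {h} u ¬charged = subst (_< usefulCount i j) (sym (charged≡sum-chargedAt i j))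
    (sum-<-at h (chargedAt≤useful i j) (chargedAt<useful u ¬charged))

  charged+edge≤usefulCount : ∀ {v₀} → Pendant v₀ → ∀ i j → charged i j + 𝟙 (Edge? i j) ≤ usefulCount i j
  charged+edge≤usefulCount p₀ i j with Edge? i j
  ... | no _ = subst (_≤ usefulCount i j) (sym (+-identityʳ _)) (charged≤usefulCount i j)
  ... | yes edge with edge-has-uncharged-head p₀ edge
  ...   | h , u , ¬charged = subst (_≤ usefulCount i j) (+-comm 1 _) (charged<usefulCount u ¬charged)

  owned-uncharged : ∀ {a i j h} → LeafNbr a h → a ≡ i ⊎ a ≡ j → ¬ ∃ (λ v → Charges v i j h)
  owned-uncharged (ah , leaf) a-on (v , _ , (vh , _) , v≢i , v≢j)
    with leaf-nbr-unique leaf (adj-sym ah) (adj-sym vh)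
  ... | refl = [ v≢i , v≢j ]′ a-on

  bonus-owns : ∀ {v i j} → Bonus v i j → ¬ Leaf i → ¬ Leaf j → Owns v i j
  bonus-owns (_ , _ , _ , inj₁ leaf)         ¬leaf-i _       = contradiction leaf ¬leaf-i
  bonus-owns (_ , _ , _ , inj₂ (inj₁ leaf))  _       ¬leaf-j = contradiction leaf ¬leaf-j
  bonus-owns (_ , _ , _ , inj₂ (inj₂ owns))  _       _       = owns

  both-bonus : ∀ {i j} → Bonus i i j → Bonus j i j → 2 + charged i j ≤ usefulCount i j
  both-bonus {i} {j} bi@((¬leaf-i , _) , _) bj@((¬leaf-j , _) , _)
    with bonus-owns bi ¬leaf-i ¬leaf-j | bonus-owns bj ¬leaf-i ¬leaf-j
  ... | h₁ , u₁ , (ih₁ , h₁-leaf) | h₂ , u₂ , (jh₂ , h₂-leaf) =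
    subst (λ c → 2 + c ≤ usefulCount i j) (sym (charged≡sum-chargedAt i j))
      (sum-<-at₂ h₁ h₂ h₁≢h₂ (chargedAt≤useful i j)
        (chargedAt<useful u₁ (owned-uncharged (ih₁ , h₁-leaf) (inj₁ refl)))
        (chargedAt<useful u₂ (owned-uncharged (jh₂ , h₂-leaf) (inj₂ refl))))
    where
    h₁≢h₂ : h₁ ≢ h₂
    h₁≢h₂ refl = <⇒≢ (useful-ordered u₁) (cong toℕ (leaf-nbr-unique h₁-leaf (adj-sym ih₁) (adj-sym jh₂)))

  bonus≤endpoints : ∀ i j → bonus i j ≤ 𝟙 (Bonus? i i j) + 𝟙 (Bonus? j i j)
  bonus≤endpoints i j = sum-≤-pair _ i j λ v v≢i v≢j → 𝟙-no (Bonus? v i j) (λ b → [ v≢i , v≢j ]′ (proj₁ (proj₂ b)))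

  bonus⇒2≤usefulCount : ∀ i j → 1 ≤ bonus i j → 2 ≤ usefulCount i j
  bonus⇒2≤usefulCount i j b≥1 = proj₁ (proj₂ (proj₂ (proj₂ (count-witness (λ v → Bonus? v i j) b≥1))))

  pair-budget : ∀ {v₀} → Pendant v₀ → ∀ i j →
    𝟙 (Edge? i j) + 𝟙 (Edge? i j) + (charged i j + bonus i j) ≤ usefulCount i j + usefulCount i j
  pair-budget p₀ i j with Bonus? i i j | Bonus? j i j | bonus≤endpoints i j
  ... | yes bi | yes bj | b≤2 = budget-double (𝟙≤1 (Edge? i j)) (both-bonus bi bj) b≤2
  ... | no _   | bj?    | b≤  = budget-single (𝟙≤1 (Edge? i j)) (charged+edge≤usefulCount p₀ i j)
                                  (≤-trans b≤ (𝟙≤1 bj?)) (bonus⇒2≤usefulCount i j)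
  ... | yes _  | no _   | b≤  = budget-single (𝟙≤1 (Edge? i j)) (charged+edge≤usefulCount p₀ i j)
                                  b≤ (bonus⇒2≤usefulCount i j)

  module Payment {v} (pendant : Pendant v) where

    open PendantOf pendant

    Charged : Set
    Charged = ∃₂ λ i j → ∃ λ h → Useful i j h × Charges v i j h

    Charged? : Dec Charged
    Charged? = Fin.any? λ i → Fin.any? λ j → Fin.any? λ h → Useful? i j h ×-dec Charges? v i j h

    Bonused : Set
    Bonused = ∃₂ (Bonus v)

    nonleaf-nbr≡core : ∀ {b} → Adj v b → ¬ LeafNbr v b → b ≡ core
    nonleaf-nbr≡core vb ¬leaf-nbr = [ (λ b≡core → b≡core) , (λ leaf → contradiction (vb , leaf) ¬leaf-nbr) ]′
                                      (nbr-core-or-leaf vb)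

    -- The vertices that are not leaf neighbours of v include the edge v–core, so some useful arc
    -- fires into a leaf at v; unless it charges v, its body is {v, core}.
    fed-by-core : ¬ Charged → ∃ λ h → Fires v core h × LeafNbr v h
    fed-by-core ¬charged with Fin.any? (λ h → Fires? v core h ×-dec LeafNbr? v h)
    ... | yes found = found
    ... | no ¬found = ⊥-elim (fires-closed-total adj-core closed
                        (λ (vv , _) → adj-irrefl vv refl) (λ (_ , leaf) → core-nonleaf leaf)
                        (proj₁ leaf-nbr) (proj₂ leaf-nbr))
      where
      closed : FiresClosed (λ z → ¬ LeafNbr v z)
      closed {a} {b} {h} ab fires ¬a ¬b v-h with v Fin.≟ a | v Fin.≟ b
      ... | yes refl | _        = ¬found (h , subst (λ c → Fires v c h) (nonleaf-nbr≡core ab ¬b) fires , v-h)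
      ... | no _     | yes refl = ¬found (h , subst (λ c → Fires v c h) (nonleaf-nbr≡core (adj-sym ab) ¬a) (fires-sym fires) , v-h)
      ... | no v≢a   | no v≢b   = ¬charged ([ (λ u → a , b , h , u , pendant , v-h , v≢a , v≢b)
                                            , (λ u → b , a , h , u , pendant , v-h , v≢b , v≢a) ]′ fires)

    pair-bonus-or-unique : ∀ {i j h₁} → Useful i j h₁ → LeafNbr v h₁ → v ≡ i ⊎ v ≡ j →
                           Bonused ⊎ (∀ {h} → Fires i j h → h ≡ h₁)
    pair-bonus-or-unique {i} {j} u v-h₁ v-on with 2 ≤? usefulCount i j
    ... | yes 2≤K = inj₁ (i , j , pendant , v-on , 2≤K , inj₂ (inj₂ (_ , u , v-h₁)))
    ... | no 2≰K  = inj₂ (fires-unique (2≰⇒≤1 2≰K) u)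

    core-bonus-or-unique : ∀ {h₁} → Fires v core h₁ → LeafNbr v h₁ → Bonused ⊎ (∀ {h} → Fires v core h → h ≡ h₁)
    core-bonus-or-unique (inj₁ u) v-h₁ = pair-bonus-or-unique u v-h₁ (inj₁ refl)
    core-bonus-or-unique (inj₂ u) v-h₁ with pair-bonus-or-unique u v-h₁ (inj₂ refl)
    ... | inj₁ bonused = inj₁ bonused
    ... | inj₂ unique  = inj₂ (unique ∘ fires-sym)

    leaf-bonus-or-unique : Bonused ⊎ (∀ {ℓ h h′} → LeafNbr v ℓ → Fires v ℓ h → Fires v ℓ h′ → h ≡ h′)
    leaf-bonus-or-unique with Fin.any? (λ ℓ → LeafNbr? v ℓ ×-dec ((2 ≤? usefulCount v ℓ) ⊎-dec (2 ≤? usefulCount ℓ v)))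
    ... | yes (ℓ , (_ , leaf) , inj₁ 2≤K) = inj₁ (v , ℓ , pendant , inj₁ refl , 2≤K , inj₂ (inj₁ leaf))
    ... | yes (ℓ , (_ , leaf) , inj₂ 2≤K) = inj₁ (ℓ , v , pendant , inj₂ refl , 2≤K , inj₁ leaf)
    ... | no ¬big = inj₂ λ v-ℓ → fires-unique₂ (2≰⇒≤1 λ 2≤K → ¬big (_ , v-ℓ , inj₁ 2≤K))
                                                (2≰⇒≤1 λ 2≤K → ¬big (_ , v-ℓ , inj₂ 2≤K))

    module ClosedNeighbourhood {h₁} (v-h₁ : LeafNbr v h₁)
      (core-unique-head : ∀ {h} → Fires v core h → h ≡ h₁)
      (leaf-unique-head : ∀ {ℓ h h′} → LeafNbr v ℓ → Fires v ℓ h → Fires v ℓ h′ → h ≡ h′) where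

      N : Fin n → Set
      N x = x ≡ v ⊎ Adj v x

      N? : ∀ x → Dec (N x)
      N? x = (x Fin.≟ v) ⊎-dec Adj? v x

      edge-meets-v : ∀ {a b} → Adj a b → N a → N b → a ≡ v ⊎ b ≡ v
      edge-meets-v ab (inj₁ a≡v) _          = inj₁ a≡v
      edge-meets-v ab _          (inj₁ b≡v) = inj₂ b≡v
      edge-meets-v ab (inj₂ va)  (inj₂ vb) with nbr-core-or-leaf va | nbr-core-or-leaf vb
      ... | inj₂ a-leaf | _           = inj₂ (sym (leaf-nbr-unique a-leaf (adj-sym va) ab))
      ... | _           | inj₂ b-leaf = inj₁ (sym (leaf-nbr-unique b-leaf (adj-sym vb) (adj-sym ab)))
      ... | inj₁ a≡core | inj₁ b≡core = ⊥-elim (adj-irrefl ab (trans a≡core (sym b≡core)))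

      leaf-fires-inside : ∀ {ℓ h} → LeafNbr v ℓ → Fires v ℓ h → N h
      leaf-fires-inside {ℓ} {h} (vℓ , ℓ-leaf) fires with N? h
      ... | yes inside = inside
      ... | no outside = ⊥-elim (core-off (fires-closed-total vℓ closed (inj₂ (inj₁ refl)) (inj₂ (inj₂ refl)) core))
        where
        Triangle : Fin n → Set
        Triangle z = z ≡ h ⊎ z ≡ v ⊎ z ≡ ℓ
        h-isolated : ∀ {z} → z ≡ v ⊎ z ≡ ℓ → ¬ Adj z h
        h-isolated (inj₁ refl) vh = outside (inj₂ vh)
        h-isolated (inj₂ refl) ℓh = outside (inj₁ (sym (leaf-nbr-unique ℓ-leaf (adj-sym vℓ) ℓh)))
        closed : FiresClosed Triangle
        closed ab f (inj₁ refl) (inj₁ refl) = ⊥-elim (adj-irrefl ab refl)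
        closed ab f (inj₁ refl) (inj₂ b-on) = ⊥-elim (h-isolated b-on (adj-sym ab))
        closed ab f (inj₂ a-on) (inj₁ refl) = ⊥-elim (h-isolated a-on ab)
        closed ab f (inj₂ a-on) (inj₂ b-on) with in-pair-distinct (adj-irrefl ab) a-on b-on
        ... | inj₁ (refl , refl) = inj₁ (leaf-unique-head (vℓ , ℓ-leaf) f fires)
        ... | inj₂ (refl , refl) = inj₁ (leaf-unique-head (vℓ , ℓ-leaf) (fires-sym f) fires)
        core-off : ¬ Triangle core
        core-off (inj₁ core≡h)        = outside (inj₂ (subst (Adj v) core≡h adj-core))
        core-off (inj₂ (inj₁ core≡v)) = adj-irrefl adj-core (sym core≡v)
        core-off (inj₂ (inj₂ core≡ℓ)) = core-nonleaf (subst Leaf (sym core≡ℓ) ℓ-leaf)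

      fires-from-v-inside : ∀ {u h} → Adj v u → Fires v u h → N h
      fires-from-v-inside vu fires with nbr-core-or-leaf vu
      ... | inj₁ u≡core = inj₂ (subst (Adj v) (sym h≡h₁) (proj₁ v-h₁))
        where
        h≡h₁ : _ ≡ h₁
        h≡h₁ = core-unique-head (subst (λ c → Fires v c _) u≡core fires)
      ... | inj₂ u-leaf = leaf-fires-inside (vu , u-leaf) fires

      closed : FiresClosed N
      closed ab fires na nb with edge-meets-v ab na nb
      ... | inj₁ refl = fires-from-v-inside ab fires
      ... | inj₂ refl = fires-from-v-inside (adj-sym ab) (fires-sym fires)

      beyond-outside : ¬ N (proj₁ beyond-core)
      beyond-outside (inj₁ y≡v) = proj₂ (proj₂ beyond-core) y≡v
      beyond-outside (inj₂ vy) with nbr-core-or-leaf vy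
      ... | inj₁ y≡core = adj-irrefl (proj₁ (proj₂ beyond-core)) (sym y≡core)
      ... | inj₂ y-leaf = adj-irrefl adj-core (leaf-nbr-unique y-leaf (adj-sym vy) (adj-sym (proj₁ (proj₂ beyond-core))))

      impossible : ⊥
      impossible = beyond-outside (fires-closed-total adj-core closed (inj₁ refl) (inj₂ adj-core) (proj₁ beyond-core))

    paid : Charged ⊎ Bonused
    paid with Charged?
    ... | yes charged = inj₁ charged
    ... | no ¬charged with fed-by-core ¬charged
    ...   | h₁ , fires₁ , v-h₁ with core-bonus-or-unique fires₁ v-h₁ | leaf-bonus-or-unique
    ...     | inj₁ bonused | _            = inj₂ bonused
    ...     | inj₂ _       | inj₁ bonused = inj₂ bonused
    ...     | inj₂ core-u  | inj₂ leaf-u  = ⊥-elim (ClosedNeighbourhood.impossible v-h₁ core-u leaf-u)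

  payment : Fin n → Fin n → Fin n → ℕ
  payment v i j = chargedBy v i j + 𝟙 (Bonus? v i j)

  pendant-paid : ∀ {v} → Pendant v → 1 ≤ ∑² (payment v)
  pendant-paid {v} pendant with Payment.paid pendant
  ... | inj₁ (i , j , h , charges) = ≤-trans (count≥1 (λ h → Useful? i j h ×-dec Charges? v i j h) charges)
                                       (≤-trans (m≤m+n _ _) (point≤∑² (payment v) i j))
  ... | inj₂ (i , j , b) = ≤-trans (≤-reflexive (sym (𝟙-yes (Bonus? v i j) b)))
                             (≤-trans (m≤n+m _ _) (point≤∑² (payment v) i j))

  ell≤charged+bonus : ell G ≤ ∑² (λ i j → charged i j + bonus i j)
  ell≤charged+bonus = begin
    ell G
      ≡⟨ ell≡count ⟩
    count Pendant?
      ≤⟨ sum-mono-≤ (λ v → 𝟙-≤ (Pendant? v) pendant-paid) ⟩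
    sum (λ v → ∑² (payment v))
      ≡⟨ ∑-∑²-comm payment ⟩
    ∑² (λ i j → sum (λ v → payment v i j))
      ≡⟨ sum-cong-≗ (λ i → sum-cong-≗ λ j → ∑-distrib-+ (λ v → chargedBy v i j) (λ v → 𝟙 (Bonus? v i j))) ⟩
    ∑² (λ i j → charged i j + bonus i j)
      ∎
    where open ≤-Reasoning

  double-count : ∀ {v₀} → Pendant v₀ → numEdges G + numEdges G + ell G ≤ length F + length F
  double-count p₀ = begin
    numEdges G + numEdges G + ell G
      ≤⟨ +-mono-≤ (≤-reflexive (cong₂ _+_ numEdges≡sum numEdges≡sum)) ell≤charged+bonus ⟩
    ∑² E + ∑² E + ∑² P
      ≡⟨ sym (trans (∑²-distrib-+ (λ i j → E i j + E i j) P) (cong (_+ ∑² P) (∑²-distrib-+ E E))) ⟩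
    ∑² (λ i j → E i j + E i j + P i j)
      ≤⟨ ∑²-mono-≤ (pair-budget p₀) ⟩
    ∑² (λ i j → usefulCount i j + usefulCount i j)
      ≡⟨ ∑²-distrib-+ usefulCount usefulCount ⟩
    ∑² usefulCount + ∑² usefulCount
      ≤⟨ +-mono-≤ usefulCount≤length usefulCount≤length ⟩
    length F + length F
      ∎
    where
    open ≤-Reasoning
    E P : Fin n → Fin n → ℕ
    E i j = 𝟙 (Edge? i j)
    P i j = charged i j + bonus i j

-- Duplicate hyperarcs only lengthen F.
corollary6p3 : ∀ (n : ℕ) (G : Graph n) → (∀ v → 1 ≤ deg G v) → 2 ≤ ell G →
    ∀ (F : List (Hyperarc n)) → Unique F → Represents F G →
    numEdges G + ⌈ ell G /2⌉ ≤ length F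
corollary6p3 n G no-isolated 2≤ell F _ represents = half-bound {numEdges G} (double-count (proj₂ pendant))
  where
  open GraphFacts G
  open Representation G F represents no-isolated
  pendant : ∃ Pendant
  pendant = count-witness Pendant? (≤-trans (≤-trans (s≤s z≤n) 2≤ell) (≤-reflexive ell≡count))
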